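{- If $G$ is a non-empty cactus that has no end-block isomorphic to $C_4$, then Staller has a winning strategy in the S-game of the Maker-Breaker total domination game on $G$.
   Context: The Maker-Breaker total domination game on a graph is played by Dominator and Staller, who alternately select a vertex not selected before. Dominator wins if at some point the set of vertices he has selected is a total dominating set (every vertex has a neighbour in it); otherwise Staller wins. The S-game is the game in which Staller moves first. A cactus is a connected graph each of whose blocks is a cycle or $K_2$ (the single-vertex graph $K_1$ is included). An end-block is a block intersecting the other blocks in at most one vertex. -}

module Defs where

open import Data.Nat using (ℕ; zero; suc; _≤_; _%_)
open import Data.Nat as ℕ using ()
open import Data.Fin using (Fin; toℕ)
open import Data.Fin.Subset using (Subset; _∈_; _∉_; _⊆_; _∪_; _-_; ⁅_⁆; ⊥; ⊤)
open import Data.Product using (Σ; ∃; ∃-syntax; _×_; _,_)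
open import Data.Sum using (_⊎_)
open import Relation.Nullary using (¬_; Dec)
open import Relation.Binary.PropositionalEquality using (_≡_; _≢_)
open import Function.Bundles using (_⇔_)

record Graph (n : ℕ) : Set₁ where
  field
    Adj    : Fin n → Fin n → Set
    adj?   : (u v : Fin n) → Dec (Adj u v)
    sym    : ∀ {u v} → Adj u v → Adj v u
    irrefl : ∀ {u} → ¬ Adj u u

CycSucc : (k : ℕ) → Fin k → Fin k → Set
CycSucc k i j = toℕ j ≡ suc (toℕ i) ⊎ (suc (toℕ i) ≡ k × toℕ j ≡ 0)

module _ {n : ℕ} (G : Graph n) where
  open Graph G

  data WalkIn (B : Subset n) : Fin n → Fin n → Set where
    here : ∀ {u} → u ∈ B → WalkIn B u u
    step : ∀ {u w v} → u ∈ B → Adj u w → WalkIn B w v → WalkIn B u v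

  -- The induced subgraph G[B] is connected (the empty set counts as connected).
  ConnectedOn : Subset n → Set
  ConnectedOn B = ∀ u v → u ∈ B → v ∈ B → WalkIn B u v

  Connected : Set
  Connected = ConnectedOn ⊤

  Nonseparable : Subset n → Set
  Nonseparable B = (∃[ x ] x ∈ B) × ConnectedOn B × (∀ x → x ∈ B → ConnectedOn (B - x))

  IsBlock : Subset n → Set
  IsBlock B = Nonseparable B × (∀ B′ → B ⊆ B′ → Nonseparable B′ → B′ ⊆ B)

  IsK1On : Subset n → Set
  IsK1On B = ∃[ u ] (∀ w → (w ∈ B) ⇔ (w ≡ u))

  IsK2On : Subset n → Set
  IsK2On B = ∃[ u ] ∃[ v ] (u ≢ v × Adj u v × (∀ w → (w ∈ B) ⇔ (w ≡ u ⊎ w ≡ v)))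

  IsCycleOn : ℕ → Subset n → Set
  IsCycleOn k B =
    3 ≤ k × Σ (Fin k → Fin n) λ f →
      (∀ i j → f i ≡ f j → i ≡ j) ×
      (∀ w → (w ∈ B) ⇔ (∃[ i ] f i ≡ w)) ×
      (∀ i j → Adj (f i) (f j) ⇔
         (CycSucc k i j ⊎ CycSucc k j i))

  IsCactus : Set
  IsCactus = Connected ×
    (∀ B → IsBlock B → IsK1On B ⊎ IsK2On B ⊎ (∃[ k ] IsCycleOn k B))

  -- An end-block: a block meeting the other blocks in at most one vertex.
  IsEndBlock : Subset n → Set
  IsEndBlock B = IsBlock B ×
    (∀ x y → x ∈ B → y ∈ B →
      (∃[ B′ ] (IsBlock B′ × B′ ≢ B × x ∈ B′)) →
      (∃[ B″ ] (IsBlock B″ × B″ ≢ B × y ∈ B″)) →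
      x ≡ y)

  TotalDominating : Subset n → Set
  TotalDominating D = ∀ v → ∃[ u ] (u ∈ D × Adj u v)

  -- Positions: (D, S) = vertices chosen
  -- by Dominator and by Staller.  StallerWinsS D S: Staller is to move and has
  -- a winning strategy; StallerWinsD D S: Dominator is to move and Staller has
  -- a winning strategy.  Dominator wins as soon as D is total dominating;
  -- Staller wins if the board is exhausted before that.
  data StallerWinsS : Subset n → Subset n → Set
  data StallerWinsD : Subset n → Subset n → Set

  data StallerWinsS where
    exhausted : ∀ {D S} → ¬ TotalDominating D → (∀ v → v ∈ D ⊎ v ∈ S) →
                StallerWinsS D S
    move      : ∀ {D S} → ¬ TotalDominating D → (v : Fin n) → v ∉ D → v ∉ S →
                StallerWinsD D (S ∪ ⁅ v ⁆) → StallerWinsS D S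

  data StallerWinsD where
    respond : ∀ {D S} → (∀ v → v ∉ D → v ∉ S → StallerWinsS (D ∪ ⁅ v ⁆) S) →
              StallerWinsD D S

  StallerWinsSGame : Set
  StallerWinsSGame = StallerWinsS ⊥ ⊥

-- Staller wins as soon as some vertex u has all its neighbours claimed by her.
-- She can force this in the S-game whenever G has a pendant vertex u (claim its
-- neighbour) or a fork: a path p u₁ w u₂ q with N(u₁) ⊆ {p, w}, N(u₂) ⊆ {w, q}
-- (claim w; Dominator can take only one of p, q, and Staller claims the other).
-- Every non-empty cactus has an end-block B attached to the rest of G at a single
-- vertex c, and then B is K₁ (G is a single vertex), K₂ (a pendant vertex), a
-- triangle (a fork with w = c) or a cycle of length ≥ 5 (a fork on five
-- consecutive vertices of the cycle, avoiding c as u₁ and u₂); only C₄ fails.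
-- An end-block is found classically, from a branch at a cut vertex of minimum
-- size; since the existence of a pendant vertex or fork is decidable, the
-- double negation can be removed at the end.
module Submission where

open import Defs
open import Data.Nat using (ℕ; suc)
open import Data.Fin.Subset using (Subset)
open import Relation.Nullary using (¬_)

open import Data.Nat using (zero; _+_; _<_; _≤_; s≤s)
import Data.Nat.Properties as ℕ
open import Data.Fin using (Fin; toℕ; fromℕ) renaming (zero to 0F; suc to sucF)
open import Data.Fin.Patterns using (1F; 2F; 3F; 4F)
open import Data.Fin.Properties using (_≟_; any?; all?; toℕ<n; toℕ-fromℕ; toℕ-injective)
open import Data.Fin.Subset using (_∈_; _∉_; _⊆_; _⊂_; _∪_; _─_; _-_; ⁅_⁆; ∁; ∣_∣; ⊤; ⊥; inside; outside)
open import Data.Fin.Subset.Properties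
  using (_∈?_; ∈⊤; ⊆⊤; ∉⊥; x∈⁅x⁆; x∈⁅y⁆⇒x≡y; x∉⁅y⁆⇒x≢y; x∈p∪q⁻; x∈p∪q⁺; p⊆p∪q; q⊆p∪q; ∪-identityˡ;
         x∈p∧x≢y⇒x∈p-y; p─q⊆p; p⊂q⇒∁p⊃∁q; p⊂q⇒∣p∣<∣q∣; ∣p∣≤n; ⊆-antisym; drop-there)
open import Data.Vec using (_∷_; []; here; there)
open import Data.Product using (∃-syntax; _×_; _,_; proj₁; proj₂)
open import Data.Sum as Sum using (_⊎_; inj₁; inj₂; [_,_]′)
open import Data.Empty using (⊥-elim)
open import Function using (_∘_; id)
open import Function.Bundles using (_⇔_; mk⇔; Equivalence)
open import Relation.Nullary using (Dec; yes; no)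
open import Relation.Nullary.Decidable using (¬?; _×-dec_; _⊎-dec_; _→-dec_; decidable-stable; ¬¬-excluded-middle)
open import Relation.Nullary.Negation using (¬¬-map; ¬¬-Monad)
open import Effect.Monad using (RawMonad)
open import Level using (0ℓ)
open import Relation.Binary.PropositionalEquality using (_≡_; _≢_; refl; sym; trans; cong; subst)

open Equivalence using (to; from)
open RawMonad (¬¬-Monad {0ℓ}) using (_>>=_; pure)

private
  variable
    m : ℕ
    A A′ : Set

-- Classical reasoning under a double negation

¬¬-by-cases : (A → ¬ ¬ A′) → (¬ A → ¬ ¬ A′) → ¬ ¬ A′
¬¬-by-cases f g ¬a′ = g (λ a → f a ¬a′) ¬a′

¬¬-Π-dec : Dec A → (A → ¬ ¬ A′) → ¬ ¬ (A → A′)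
¬¬-Π-dec (yes a) f = ¬¬-map (λ b _ → b) (f a)
¬¬-Π-dec (no ¬a) f = pure (⊥-elim ∘ ¬a)

¬¬-∀ : {P : Fin m → Set} → (∀ i → ¬ ¬ P i) → ¬ ¬ (∀ i → P i)
¬¬-∀ {zero}  h = pure λ ()
¬¬-∀ {suc m} h = h 0F >>= λ p0 → ¬¬-∀ (h ∘ sucF) >>= λ ps →
  pure λ { 0F → p0 ; (sucF i) → ps i }

¬¬-∀∈ : {P : Fin m → Set} (S : Subset m) → (∀ i → i ∈ S → ¬ ¬ P i) → ¬ ¬ (∀ i → i ∈ S → P i)
¬¬-∀∈ S h = ¬¬-∀ λ i → ¬¬-Π-dec (i ∈? S) (h i)

decSubset : {P : Fin m → Set} → (∀ i → Dec (P i)) → ∃[ R ] (∀ i → i ∈ R ⇔ P i)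
decSubset {zero}  P? = [] , λ ()
decSubset {suc m} P? with decSubset (P? ∘ sucF) | P? 0F
... | R , R⇔ | yes p0 = inside ∷ R , λ
  { 0F → mk⇔ (λ _ → p0) (λ _ → here)
  ; (sucF i) → mk⇔ (to (R⇔ i) ∘ drop-there) (there ∘ from (R⇔ i)) }
... | R , R⇔ | no ¬p0 = outside ∷ R , λ
  { 0F → mk⇔ (λ ()) (⊥-elim ∘ ¬p0)
  ; (sucF i) → mk⇔ (to (R⇔ i) ∘ drop-there) (there ∘ from (R⇔ i)) }

¬¬-subset : (P : Fin m → Set) → ¬ ¬ (∃[ R ] (∀ i → i ∈ R ⇔ P i))
¬¬-subset P = ¬¬-map decSubset (¬¬-∀ λ _ → ¬¬-excluded-middle)

-- The Maker-Breaker total domination game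

∈⊥∪⁅⁆⁻ : ∀ {x y : Fin m} → x ∈ ⊥ ∪ ⁅ y ⁆ → x ≡ y
∈⊥∪⁅⁆⁻ {y = y} = x∈⁅y⁆⇒x≡y y ∘ subst (_ ∈_) (∪-identityˡ ⁅ y ⁆)

∈⊥∪⁅⁆⁺ : ∀ {x y : Fin m} → x ≡ y → x ∈ ⊥ ∪ ⁅ y ⁆
∈⊥∪⁅⁆⁺ {x = x} refl = subst (x ∈_) (sym (∪-identityˡ ⁅ x ⁆)) (x∈⁅x⁆ x)

module Game {N : ℕ} (G : Graph N) where
  open Graph G using (Adj; adj?)

  private
    variable
      D S : Subset N
      u v : Fin N

  Starved : Subset N → Subset N → Fin N → Set
  Starved D S u = ∀ y → Adj y u → y ∈ S × y ∉ D

  starved⇒¬dominating : Starved D S u → ¬ TotalDominating G D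
  starved⇒¬dominating {u = u} starved dominating =
    let y , y∈D , y~u = dominating u in proj₂ (starved y y~u) y∈D

  starved-claimˢ : Starved D S u → Starved D (S ∪ ⁅ v ⁆) u
  starved-claimˢ starved y y~u = let y∈S , y∉D = starved y y~u in p⊆p∪q _ y∈S , y∉D

  starved-claimᴰ : v ∉ S → Starved D S u → Starved (D ∪ ⁅ v ⁆) S u
  starved-claimᴰ {D = D} v∉S starved y y~u =
    let y∈S , y∉D = starved y y~u
    in y∈S , [ y∉D , (λ y∈⁅v⁆ → v∉S (subst (_∈ _) (x∈⁅y⁆⇒x≡y _ y∈⁅v⁆) y∈S)) ]′ ∘ x∈p∪q⁻ D _

  free : Subset N → Subset N → ℕ
  free D S = ∣ ∁ (D ∪ S) ∣

  ∣∁∣-shrinks : ∀ {P Q : Subset N} → P ⊂ Q → ∣ ∁ Q ∣ < ∣ ∁ P ∣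
  ∣∁∣-shrinks = p⊂q⇒∣p∣<∣q∣ ∘ p⊂q⇒∁p⊃∁q

  free-claimᴰ : v ∉ D ∪ S → free (D ∪ ⁅ v ⁆) S < free D S
  free-claimᴰ {v} {D} {S} v∉ = ∣∁∣-shrinks
    ( [ x∈p∪q⁺ ∘ inj₁ ∘ p⊆p∪q _ , x∈p∪q⁺ ∘ inj₂ ]′ ∘ x∈p∪q⁻ D S
    , v , x∈p∪q⁺ (inj₁ (q⊆p∪q D _ (x∈⁅x⁆ v))) , v∉ )

  free-claimˢ : v ∉ D ∪ S → free D (S ∪ ⁅ v ⁆) < free D S
  free-claimˢ {v} {D} {S} v∉ = ∣∁∣-shrinks
    ( [ x∈p∪q⁺ ∘ inj₁ , x∈p∪q⁺ ∘ inj₂ ∘ p⊆p∪q _ ]′ ∘ x∈p∪q⁻ D S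
    , v , x∈p∪q⁺ (inj₂ (q⊆p∪q S _ (x∈⁅x⁆ v))) , v∉ )

  mutual
    starved⇒winsS : ∀ k → free D S < k → Starved D S u → StallerWinsS G D S
    starved⇒winsS {D} {S} (suc k) free<k starved with any? (λ v → ¬? (v ∈? D ∪ S))
    ... | yes (v , v∉) =
      move (starved⇒¬dominating starved) v (v∉ ∘ p⊆p∪q S) (v∉ ∘ q⊆p∪q D S)
        (starved⇒winsD k (ℕ.<⇒≤ (ℕ.<-≤-trans (free-claimˢ v∉) (ℕ.≤-pred free<k)))
                         (starved-claimˢ starved))
    ... | no none = exhausted (starved⇒¬dominating starved) λ v →
      x∈p∪q⁻ D S (decidable-stable (v ∈? D ∪ S) (none ∘ (v ,_)))

    starved⇒winsD : ∀ k → free D S ≤ k → Starved D S u → StallerWinsD G D S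
    starved⇒winsD {D} {S} k free≤k starved = respond λ v v∉D v∉S →
      starved⇒winsS k (ℕ.<-≤-trans (free-claimᴰ ([ v∉D , v∉S ]′ ∘ x∈p∪q⁻ D S)) free≤k)
                      (starved-claimᴰ v∉S starved)

  starved⇒stallerWinsD : Starved D S u → StallerWinsD G D S
  starved⇒stallerWinsD {D} {S} = starved⇒winsD N (∣p∣≤n (∁ (D ∪ S)))

  Pendant : Set
  Pendant = ∃[ u ] ∃[ w ] (∀ y → Adj y u → y ≡ w)

  Fork : Set
  Fork = ∃[ w ] ∃[ p ] ∃[ q ] ∃[ u₁ ] ∃[ u₂ ]
    (p ≢ q × p ≢ w × q ≢ w ×
     (∀ y → Adj y u₁ → y ≡ p ⊎ y ≡ w) × (∀ y → Adj y u₂ → y ≡ w ⊎ y ≡ q))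

  Trap : Set
  Trap = Pendant ⊎ Fork

  trap? : Dec Trap
  trap? =
    (any? λ u → any? λ w → all? λ y → adj? y u →-dec y ≟ w)
    ⊎-dec
    (any? λ w → any? λ p → any? λ q → any? λ u₁ → any? λ u₂ →
       ¬? (p ≟ q) ×-dec ¬? (p ≟ w) ×-dec ¬? (q ≟ w)
       ×-dec (all? λ y → adj? y u₁ →-dec (y ≟ p ⊎-dec y ≟ w))
       ×-dec (all? λ y → adj? y u₂ →-dec (y ≟ w ⊎-dec y ≟ q)))

  ¬dominating-∅ : Fin N → ¬ TotalDominating G ⊥
  ¬dominating-∅ v dominating = ∉⊥ (proj₁ (proj₂ (dominating v)))

  pendant⇒stallerWins : Pendant → StallerWinsSGame G
  pendant⇒stallerWins (u , w , N[u]≡w) =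
    move (¬dominating-∅ w) w ∉⊥ ∉⊥
      (starved⇒stallerWinsD λ y y~u → ∈⊥∪⁅⁆⁺ (N[u]≡w y y~u) , ∉⊥)

  fork⇒stallerWins : Fork → StallerWinsSGame G
  fork⇒stallerWins (w , p , q , u₁ , u₂ , p≢q , p≢w , q≢w , N[u₁] , N[u₂]) =
    move (¬dominating-∅ w) w ∉⊥ ∉⊥
      (respond λ d _ d∉S → reply d (d∉S ∘ ∈⊥∪⁅⁆⁺))
    where
    claim : ∀ {d} x u → d ≢ w → x ≢ d → x ≢ w → (∀ y → Adj y u → y ≡ w ⊎ y ≡ x) →
            StallerWinsS G (⊥ ∪ ⁅ d ⁆) (⊥ ∪ ⁅ w ⁆)
    claim {d} x u d≢w x≢d x≢w N[u] =
      move (starved⇒¬dominating starved) x (x≢d ∘ ∈⊥∪⁅⁆⁻) (x≢w ∘ ∈⊥∪⁅⁆⁻)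
        (starved⇒stallerWinsD starved)
      where
      starved : Starved (⊥ ∪ ⁅ d ⁆) ((⊥ ∪ ⁅ w ⁆) ∪ ⁅ x ⁆) u
      starved y y~u with N[u] y y~u
      ... | inj₁ refl = p⊆p∪q _ (∈⊥∪⁅⁆⁺ refl) , d≢w ∘ sym ∘ ∈⊥∪⁅⁆⁻
      ... | inj₂ refl = q⊆p∪q _ _ (x∈⁅x⁆ x) , x≢d ∘ ∈⊥∪⁅⁆⁻

    reply : ∀ d → d ≢ w → StallerWinsS G (⊥ ∪ ⁅ d ⁆) (⊥ ∪ ⁅ w ⁆)
    reply d d≢w with d ≟ p
    ... | yes refl = claim q u₂ d≢w (p≢q ∘ sym) q≢w N[u₂]
    ... | no d≢p   = claim p u₁ d≢w (d≢p ∘ sym) p≢w (λ y → Sum.swap ∘ N[u₁] y)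

  trap⇒stallerWins : Trap → StallerWinsSGame G
  trap⇒stallerWins = [ pendant⇒stallerWins , fork⇒stallerWins ]′

-- Walks, branches and end-blocks

x∈p─q⇒x∉q : ∀ {x : Fin m} (p q : Subset m) → x ∈ p ─ q → x ∉ q
x∈p─q⇒x∉q (_ ∷ p) (inside  ∷ q) ()          here
x∈p─q⇒x∉q (_ ∷ p) (outside ∷ q) here        ()
x∈p─q⇒x∉q (_ ∷ p) (_       ∷ q) (there x∈) (there x∈′) = x∈p─q⇒x∉q p q x∈ x∈′

x∈p-y⇒x≢y : ∀ {x y : Fin m} {p : Subset m} → x ∈ p - y → x ≢ y
x∈p-y⇒x≢y {p = p} = x∉⁅y⁆⇒x≢y ∘ x∈p─q⇒x∉q p _

module EndBlocks {N : ℕ} (G : Graph N) where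
  open Graph G renaming (sym to adj-sym)

  private
    variable
      Y C X R : Subset N
      a b c d s u v w z : Fin N

  source∈ : WalkIn G Y u v → u ∈ Y
  source∈ (here u∈) = u∈
  source∈ (step u∈ _ _) = u∈

  walk-mono : X ⊆ Y → WalkIn G X u v → WalkIn G Y u v
  walk-mono X⊆Y (here u∈) = here (X⊆Y u∈)
  walk-mono X⊆Y (step u∈ u~w r) = step (X⊆Y u∈) u~w (walk-mono X⊆Y r)

  _++_ : WalkIn G Y u v → WalkIn G Y v w → WalkIn G Y u w
  here _ ++ r′ = r′
  step u∈ u~w r ++ r′ = step u∈ u~w (r ++ r′)

  _∷ʳ_ : WalkIn G Y u v → (Adj v w × w ∈ Y) → WalkIn G Y u w
  here v∈ ∷ʳ (v~w , w∈) = step v∈ v~w (here w∈)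
  step u∈ u~x r ∷ʳ e = step u∈ u~x (r ∷ʳ e)

  reverse : WalkIn G Y u v → WalkIn G Y v u
  reverse (here u∈) = here u∈
  reverse (step u∈ u~w r) = reverse r ∷ʳ (adj-sym u~w , u∈)

  target∈ : WalkIn G Y u v → v ∈ Y
  target∈ = source∈ ∘ reverse

  Reach : Subset N → Fin N → Subset N → Set
  Reach X u R = ∀ y → y ∈ R ⇔ WalkIn G X u y

  ¬¬-reach : ∀ X u → ¬ ¬ (∃[ R ] Reach X u R)
  ¬¬-reach X u = ¬¬-subset (WalkIn G X u)

  walk-within-reach : Reach X u R → WalkIn G X u a → WalkIn G X a b → WalkIn G R a b
  walk-within-reach R⇔ u→a (here _) = here (from (R⇔ _) u→a)
  walk-within-reach R⇔ u→a (step _ a~w w→b) =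
    step (from (R⇔ _) u→a) a~w (walk-within-reach R⇔ (u→a ∷ʳ (a~w , source∈ w→b)) w→b)

  Closed : Fin N → Subset N → Set
  Closed c C = ∀ {y z} → y ∈ C → Adj y z → z ∈ C ⊎ z ≡ c

  walk-from-closed : Closed c C → s ∈ C → WalkIn G X s z →
                     z ∈ C ⊎ (c ∈ X × ∃[ y ] (y ∈ C × Adj y c))
  walk-from-closed closed s∈C (here _) = inj₁ s∈C
  walk-from-closed closed s∈C (step _ s~w w→z) with closed s∈C s~w
  ... | inj₁ w∈C = walk-from-closed closed w∈C w→z
  ... | inj₂ refl = inj₂ (source∈ w→z , _ , s∈C , s~w)

  -- C is a component of G - c that is not all of G - c; when G is connected
  -- this makes c a cut vertex.
  record Branch (c : Fin N) (C : Subset N) : Set where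
    field
      c∉C : c ∉ C
      nonempty : ∃[ y ] y ∈ C
      connected : ConnectedOn G C
      closed : Closed c C
      beyond : ∃[ v ] (v ∉ C × v ≢ c)

  reach-branch : u ∈ Y - c → Reach (Y - c) u R → (∀ {y z} → y ∈ R → Adj y z → z ∈ Y) →
                 ∃[ v ] (v ∉ R × v ≢ c) → Branch c R
  reach-branch {u} {Y} {c} {R} u∈ R⇔ R-nbrs∈Y beyond = record
    { c∉C = λ c∈R → x∈p-y⇒x≢y (target∈ (walk c∈R)) refl
    ; nonempty = u , from (R⇔ u) (here u∈)
    ; connected = λ a b a∈R b∈R → walk-within-reach R⇔ (walk a∈R) (reverse (walk a∈R) ++ walk b∈R)
    ; closed = closed
    ; beyond = beyond
    }
    where
    walk : ∀ {y} → y ∈ R → WalkIn G (Y - c) u y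
    walk = to (R⇔ _)
    closed : Closed c R
    closed {y} {z} y∈R y~z with z ≟ c
    ... | yes z≡c = inj₂ z≡c
    ... | no z≢c = inj₁ (from (R⇔ z) (walk y∈R ∷ʳ (y~z , x∈p∧x≢y⇒x∈p-y (R-nbrs∈Y y∈R y~z) z≢c)))

  MinimalBranch : Fin N → Subset N → Set
  MinimalBranch c C = Branch c C × (∀ {c′ C′} → Branch c′ C′ → ∣ C ∣ ≤ ∣ C′ ∣)

  ¬¬-minimalBranch : ∀ k → ∣ C ∣ < k → Branch c C → ¬ ¬ (∃[ c ] ∃[ C ] MinimalBranch c C)
  ¬¬-minimalBranch {C} {c} (suc k) ∣C∣<k branch = ¬¬-by-cases
    (λ (c′ , C′ , branch′ , ∣C′∣<∣C∣) →
       ¬¬-minimalBranch k (ℕ.<-≤-trans ∣C′∣<∣C∣ (ℕ.≤-pred ∣C∣<k)) branch′)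
    (λ no-smaller → pure (c , C , branch , λ {c′} {C′} branch′ →
       ℕ.≮⇒≥ λ ∣C′∣<∣C∣ → no-smaller (c′ , C′ , branch′ , ∣C′∣<∣C∣)))

  ¬¬-connected : (∀ {u v} → u ∈ X → v ∈ X → ¬ ¬ WalkIn G X u v) → ¬ ¬ ConnectedOn G X
  ¬¬-connected {X} walks = ¬¬-map (λ all u v u∈ v∈ → all u u∈ v v∈)
    (¬¬-∀∈ X λ u u∈ → ¬¬-∀∈ X λ v v∈ → walks u∈ v∈)

  record AttachedEndBlock : Set where
    field
      block : Subset N
      attachment : Fin N
      endBlock : IsEndBlock G block
      attachment∈ : attachment ∈ block
      closed : ∀ {x z} → x ∈ block → x ≢ attachment → Adj x z → z ∈ block
      whole-or-proper : (∀ z → z ∈ block) ⊎ (∃[ x ] (x ∈ block × x ≢ attachment))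

  module _ (v₀ : Fin N) (no-branch : ∀ {c C} → ¬ Branch c C) where

    ¬¬-walk : u ∈ ⊤ - c → v ∈ ⊤ - c → ¬ ¬ WalkIn G (⊤ - c) u v
    ¬¬-walk {u} {c} {v} u∈ v∈ ¬walk = ¬¬-reach (⊤ - c) u λ (R , R⇔) →
      no-branch (reach-branch u∈ R⇔ (λ _ _ → ∈⊤) (v , ¬walk ∘ to (R⇔ v) , x∈p-y⇒x≢y v∈))

    whole-graph-endBlock : Connected G → ¬ ¬ AttachedEndBlock
    whole-graph-endBlock connected = ¬¬-map attached (¬¬-∀∈ ⊤ λ _ _ → ¬¬-connected ¬¬-walk)
      where
      attached : (∀ x → x ∈ ⊤ → ConnectedOn G (⊤ - x)) → AttachedEndBlock
      attached separations = record
        { block = ⊤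
        ; attachment = v₀
        ; endBlock = isBlock , λ { _ _ _ _ (B′ , (_ , maximal) , B′≢⊤ , _) _ →
            ⊥-elim (B′≢⊤ (⊆-antisym ⊆⊤ (maximal ⊤ ⊆⊤ nonseparable))) }
        ; attachment∈ = ∈⊤
        ; closed = λ _ _ _ → ∈⊤
        ; whole-or-proper = inj₁ λ _ → ∈⊤
        }
        where
        nonseparable : Nonseparable G ⊤
        nonseparable = (v₀ , ∈⊤) , connected , separations
        isBlock : IsBlock G ⊤
        isBlock = nonseparable , λ _ _ _ → ⊆⊤

  module AroundMinimalBranch (connected : Connected G) {c : Fin N} {C : Subset N}
                             (minimalBranch : MinimalBranch c C) where
    open Branch (proj₁ minimalBranch) renaming (connected to C-connected; closed to C-closed)

    B : Subset N
    B = C ∪ ⁅ c ⁆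

    ∈B⁻ : z ∈ B → z ∈ C ⊎ z ≡ c
    ∈B⁻ = Sum.map₂ (x∈⁅y⁆⇒x≡y _) ∘ x∈p∪q⁻ C _

    C⊆B : C ⊆ B
    C⊆B = p⊆p∪q _

    c∈B : c ∈ B
    c∈B = q⊆p∪q C _ (x∈⁅x⁆ c)

    C∌c : z ∈ C → z ≢ c
    C∌c z∈C refl = c∉C z∈C

    B-c⊆C : B - c ⊆ C
    B-c⊆C z∈ = [ id , ⊥-elim ∘ x∈p-y⇒x≢y z∈ ]′ (∈B⁻ (p─q⊆p B _ z∈))

    B-closed : ∀ {x z} → x ∈ B → x ≢ c → Adj x z → z ∈ B
    B-closed x∈B x≢c x~z =
      [ C⊆B , (λ { refl → c∈B }) ]′ (C-closed (B-c⊆C (x∈p∧x≢y⇒x∈p-y x∈B x≢c)) x~z)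

    c-neighbour : ∃[ y ] (y ∈ C × Adj y c)
    c-neighbour with nonempty | beyond
    ... | y₀ , y₀∈C | v , v∉C , _ with walk-from-closed C-closed y₀∈C (connected y₀ v ∈⊤ ∈⊤)
    ...   | inj₁ v∈C = ⊥-elim (v∉C v∈C)
    ...   | inj₂ (_ , found) = found

    walk-from-neighbour : z ∈ B → WalkIn G B (proj₁ c-neighbour) z
    walk-from-neighbour z∈B with c-neighbour | ∈B⁻ z∈B
    ... | y , y∈C , _   | inj₁ z∈C = walk-mono C⊆B (C-connected y _ y∈C z∈C)
    ... | y , y∈C , y~c | inj₂ refl = step (C⊆B y∈C) y~c (here c∈B)

    B-connected : ConnectedOn G B
    B-connected a b a∈ b∈ = reverse (walk-from-neighbour a∈) ++ walk-from-neighbour b∈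

    B-c-connected : ConnectedOn G (B - c)
    B-c-connected a b a∈ b∈ =
      walk-mono (λ z∈C → x∈p∧x≢y⇒x∈p-y (C⊆B z∈C) (C∌c z∈C))
                (C-connected a b (B-c⊆C a∈) (B-c⊆C b∈))

    -- The vertices reachable from s in B - d form a branch at d strictly inside C,
    -- unless c is among them.
    reach-contains-c : s ∈ B - d → d ∈ C → Reach (B - d) s R → c ∈ R
    reach-contains-c {s} {d} {R} s∈ d∈C R⇔ with c ∈? R
    ... | yes c∈R = c∈R
    ... | no c∉R = ⊥-elim (ℕ.<⇒≱ ∣R∣<∣C∣ (proj₂ minimalBranch smaller))
      where
      R⊆C : R ⊆ C
      R⊆C {y} y∈R = [ id , (λ { refl → ⊥-elim (c∉R y∈R) }) ]′
        (∈B⁻ (p─q⊆p B _ (target∈ (to (R⇔ y) y∈R))))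
      smaller : Branch d R
      smaller = reach-branch s∈ R⇔
        (λ y∈R y~z → [ C⊆B , (λ { refl → c∈B }) ]′ (C-closed (R⊆C y∈R) y~z))
        (c , c∉R , C∌c d∈C ∘ sym)
      ∣R∣<∣C∣ : ∣ R ∣ < ∣ C ∣
      ∣R∣<∣C∣ = p⊂q⇒∣p∣<∣q∣
        (R⊆C , d , d∈C , λ d∈R → x∈p-y⇒x≢y (target∈ (to (R⇔ d) d∈R)) refl)

    ¬¬-walk-avoiding : d ∈ C → a ∈ B - d → b ∈ B - d → ¬ ¬ WalkIn G (B - d) a b
    ¬¬-walk-avoiding {d} {a} {b} d∈C a∈ b∈ ¬walk =
      ¬¬-reach (B - d) a λ (Ra , Ra⇔) → ¬¬-reach (B - d) b λ (Rb , Rb⇔) →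
        ¬walk (to (Ra⇔ c) (reach-contains-c a∈ d∈C Ra⇔)
               ++ reverse (to (Rb⇔ c) (reach-contains-c b∈ d∈C Rb⇔)))

    ¬¬-nonseparable : ¬ ¬ Nonseparable G B
    ¬¬-nonseparable = ¬¬-map (λ separations → (c , c∈B) , B-connected , separations)
      (¬¬-∀∈ B λ x x∈B → [ (λ x∈C → ¬¬-connected (¬¬-walk-avoiding x∈C))
                          , (λ { refl → pure B-c-connected }) ]′ (∈B⁻ x∈B))

    connected-without-c : ∀ {B′} → Nonseparable G B′ → ConnectedOn G (B′ - c)
    connected-without-c {B′} (_ , B′-connected , cuts) with c ∈? B′
    ... | yes c∈B′ = cuts c c∈B′
    ... | no c∉B′ = λ a b a∈ b∈ →
      walk-mono (λ z∈ → x∈p∧x≢y⇒x∈p-y z∈ λ { refl → c∉B′ z∈ })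
                (B′-connected a b (p─q⊆p B′ _ a∈) (p─q⊆p B′ _ b∈))

    -- A walk from C that avoids c cannot leave C.
    nonseparable-meeting-C⊆B : ∀ {B′ x} → Nonseparable G B′ → x ∈ B′ → x ∈ C → B′ ⊆ B
    nonseparable-meeting-C⊆B {B′} {x} ns x∈B′ x∈C {z} z∈B′ with z ≟ c
    ... | yes refl = c∈B
    ... | no z≢c with walk-from-closed C-closed x∈C
          (connected-without-c ns x z (x∈p∧x≢y⇒x∈p-y x∈B′ (C∌c x∈C)) (x∈p∧x≢y⇒x∈p-y z∈B′ z≢c))
    ...   | inj₁ z∈C = C⊆B z∈C
    ...   | inj₂ (c∈B′-c , _) = ⊥-elim (x∈p-y⇒x≢y c∈B′-c refl)

    attachedEndBlock : Nonseparable G B → AttachedEndBlock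
    attachedEndBlock ns = record
      { block = B
      ; attachment = c
      ; endBlock = isBlock , λ x y x∈B y∈B x-shared y-shared →
          trans (shared⇒≡c x∈B x-shared) (sym (shared⇒≡c y∈B y-shared))
      ; attachment∈ = c∈B
      ; closed = B-closed
      ; whole-or-proper = inj₂ (y₀ , C⊆B y₀∈C , C∌c y₀∈C)
      }
      where
      y₀ = proj₁ nonempty
      y₀∈C = proj₂ nonempty
      isBlock : IsBlock G B
      isBlock = ns , λ B′ B⊆B′ ns′ → nonseparable-meeting-C⊆B ns′ (B⊆B′ (C⊆B y₀∈C)) y₀∈C
      shared⇒≡c : ∀ {x} → x ∈ B → (∃[ B″ ] (IsBlock G B″ × B″ ≢ B × x ∈ B″)) → x ≡ c
      shared⇒≡c {x} x∈B (B″ , (ns″ , maximal″) , B″≢B , x∈B″) with ∈B⁻ x∈B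
      ... | inj₂ x≡c = x≡c
      ... | inj₁ x∈C = ⊥-elim (B″≢B (⊆-antisym B″⊆B (maximal″ B B″⊆B ns)))
        where
        B″⊆B = nonseparable-meeting-C⊆B ns″ x∈B″ x∈C

  ¬¬-attachedEndBlock : Fin N → Connected G → ¬ ¬ AttachedEndBlock
  ¬¬-attachedEndBlock v₀ connected = ¬¬-by-cases {A = ∃[ c ] ∃[ C ] Branch c C}
    (λ (_ , C , branch) →
       ¬¬-minimalBranch (suc ∣ C ∣) (ℕ.n<1+n ∣ C ∣) branch >>= λ (_ , _ , minimal) →
       let open AroundMinimalBranch connected minimal in ¬¬-map attachedEndBlock ¬¬-nonseparable)
    (λ no-branch → whole-graph-endBlock v₀ (λ branch → no-branch (_ , _ , branch)) connected)

-- End-blocks of a cactus contain traps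

module _ {k : ℕ} {i⁻ i i⁺ j : Fin k} where

  cycSucc-interior : toℕ i ≡ suc (toℕ i⁻) → toℕ i⁺ ≡ suc (toℕ i) →
                     CycSucc k i j ⊎ CycSucc k j i → toℕ j ≡ toℕ i⁻ ⊎ toℕ j ≡ toℕ i⁺
  cycSucc-interior e⁻ e⁺ (inj₁ (inj₁ j≡1+i))      = inj₂ (trans j≡1+i (sym e⁺))
  cycSucc-interior e⁻ e⁺ (inj₁ (inj₂ (1+i≡k , _))) = ⊥-elim (ℕ.<-irrefl (trans e⁺ 1+i≡k) (toℕ<n i⁺))
  cycSucc-interior e⁻ e⁺ (inj₂ (inj₁ i≡1+j))      = inj₁ (ℕ.suc-injective (trans (sym i≡1+j) e⁻))
  cycSucc-interior e⁻ e⁺ (inj₂ (inj₂ (_ , i≡0)))  = ⊥-elim (ℕ.1+n≢0 (trans (sym e⁻) i≡0))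

  cycSucc-first : toℕ i ≡ 0 → toℕ i⁺ ≡ 1 → suc (toℕ i⁻) ≡ k →
                  CycSucc k i j ⊎ CycSucc k j i → toℕ j ≡ toℕ i⁻ ⊎ toℕ j ≡ toℕ i⁺
  cycSucc-first e₀ e⁺ eˡ (inj₁ (inj₁ j≡1+i)) = inj₂ (trans j≡1+i (trans (cong suc e₀) (sym e⁺)))
  cycSucc-first e₀ e⁺ eˡ (inj₁ (inj₂ (1+i≡k , j≡0))) =
    inj₁ (ℕ.suc-injective (trans (cong suc j≡0) (trans (cong suc (sym e₀)) (trans 1+i≡k (sym eˡ)))))
  cycSucc-first e₀ e⁺ eˡ (inj₂ (inj₁ i≡1+j)) = ⊥-elim (ℕ.1+n≢0 (trans (sym i≡1+j) e₀))
  cycSucc-first e₀ e⁺ eˡ (inj₂ (inj₂ (1+j≡k , _))) = inj₁ (ℕ.suc-injective (trans 1+j≡k (sym eˡ)))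

Fin3-others : (a : Fin 3) → ∃[ i ] ∃[ j ] (i ≢ j × i ≢ a × j ≢ a × (∀ l → l ≡ a ⊎ l ≡ i ⊎ l ≡ j))
Fin3-others 0F = 1F , 2F , (λ ()) , (λ ()) , (λ ()) , λ
  { 0F → inj₁ refl ; 1F → inj₂ (inj₁ refl) ; 2F → inj₂ (inj₂ refl) }
Fin3-others 1F = 0F , 2F , (λ ()) , (λ ()) , (λ ()) , λ
  { 0F → inj₂ (inj₁ refl) ; 1F → inj₁ refl ; 2F → inj₂ (inj₂ refl) }
Fin3-others 2F = 0F , 1F , (λ ()) , (λ ()) , (λ ()) , λ
  { 0F → inj₂ (inj₁ refl) ; 1F → inj₂ (inj₂ refl) ; 2F → inj₁ refl }

module Traps {N : ℕ} (G : Graph N) (E : EndBlocks.AttachedEndBlock G) where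
  open Graph G renaming (sym to adj-sym)
  open Game G using (Pendant; Fork; Trap)
  open EndBlocks.AttachedEndBlock E renaming (block to B; attachment to c)

  pendant-of-pair : ∀ {x} → x ∈ B → x ≢ c → (∀ {z} → z ∈ B → z ≡ c ⊎ z ≡ x) → Pendant
  pendant-of-pair x∈B x≢c B⊆⁅c,x⁆ = _ , c , λ y y~x →
    [ id , (λ { refl → ⊥-elim (irrefl y~x) }) ]′ (B⊆⁅c,x⁆ (closed x∈B x≢c (adj-sym y~x)))

  K₁⇒pendant : IsK1On G B → Pendant
  K₁⇒pendant (u , B⇔u) with whole-or-proper
  ... | inj₁ whole = u , u , λ y _ → to (B⇔u y) (whole y)
  ... | inj₂ (x , x∈B , x≢c) =
    ⊥-elim (x≢c (trans (to (B⇔u x) x∈B) (sym (to (B⇔u c) attachment∈))))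

  K₂⇒pendant : IsK2On G B → Pendant
  K₂⇒pendant (u , v , u≢v , _ , B⇔uv) with to (B⇔uv c) attachment∈
  ... | inj₁ refl = pendant-of-pair (from (B⇔uv v) (inj₂ refl)) (u≢v ∘ sym) (to (B⇔uv _))
  ... | inj₂ refl = pendant-of-pair (from (B⇔uv u) (inj₁ refl)) u≢v (Sum.swap ∘ to (B⇔uv _))

  module Cycle {k : ℕ} (f : Fin k → Fin N) (f-injective : ∀ i j → f i ≡ f j → i ≡ j)
               (image : ∀ w → (w ∈ B) ⇔ (∃[ i ] f i ≡ w))
               (adj⇔ : ∀ i j → Adj (f i) (f j) ⇔ (CycSucc k i j ⊎ CycSucc k j i)) where

    f-≢ : ∀ {i j} → i ≢ j → f i ≢ f j
    f-≢ i≢j = i≢j ∘ f-injective _ _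

    f≢c : ∀ {i j} → f i ≡ c → i ≢ j → f j ≢ c
    f≢c fi≡c i≢j fj≡c = f-≢ i≢j (trans fi≡c (sym fj≡c))

    neighbour-index : ∀ {i y} → f i ≢ c → Adj y (f i) → ∃[ j ] f j ≡ y
    neighbour-index {i} {y} fi≢c y~fi =
      to (image y) (closed (from (image (f i)) (i , refl)) fi≢c (adj-sym y~fi))

    neighbours-within : ∀ i i₁ i₂ → f i ≢ c →
      (∀ {j} → CycSucc k i j ⊎ CycSucc k j i → toℕ j ≡ toℕ i₁ ⊎ toℕ j ≡ toℕ i₂) →
      ∀ y → Adj y (f i) → y ≡ f i₁ ⊎ y ≡ f i₂
    neighbours-within i _ _ fi≢c indices y y~fi with neighbour-index fi≢c y~fi
    ... | j , refl = Sum.map (cong f ∘ toℕ-injective) (cong f ∘ toℕ-injective)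
                       (indices (to (adj⇔ i j) (adj-sym y~fi)))

  triangle⇒fork : IsCycleOn G 3 B → Fork
  triangle⇒fork (_ , f , f-injective , image , adj⇔) with to (image c) attachment∈
  ... | a , fa≡c with Fin3-others a
  ... | i , j , i≢j , i≢a , j≢a , cover =
    c , f j , f i , f i , f j , f-≢ (i≢j ∘ sym) , j≢c , i≢c ,
    other-neighbours i≢a cover ,
    (λ y → Sum.swap ∘ other-neighbours j≢a (Sum.map₂ Sum.swap ∘ cover) y)
    where
    open Cycle f f-injective image adj⇔
    i≢c = f≢c fa≡c (i≢a ∘ sym)
    j≢c = f≢c fa≡c (j≢a ∘ sym)
    other-neighbours : ∀ {l l′} → l ≢ a → (∀ t → t ≡ a ⊎ t ≡ l ⊎ t ≡ l′) →
                       ∀ y → Adj y (f l) → y ≡ f l′ ⊎ y ≡ c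
    other-neighbours l≢a cover′ y y~fl with neighbour-index (f≢c fa≡c (l≢a ∘ sym)) y~fl
    ... | t , refl with cover′ t
    ... | inj₁ refl        = inj₂ fa≡c
    ... | inj₂ (inj₁ refl) = ⊥-elim (irrefl y~fl)
    ... | inj₂ (inj₂ refl) = inj₁ refl

  -- u₁ and u₂ must differ from c, whose neighbours may lie outside B: if c is
  -- neither f₁ nor f₃ use the path f₀ f₁ f₂ f₃ f₄, else the path f_{k-1} f₀ f₁ f₂ f₃.
  long-cycle⇒fork : ∀ m → IsCycleOn G (5 + m) B → Fork
  long-cycle⇒fork m (_ , f , f-injective , image , adj⇔) = fork (f 1F ≟ c) (f 3F ≟ c)
    where
    open Cycle f f-injective image adj⇔
    last = fromℕ (4 + m)

    centred-at-2 : f 1F ≢ c → f 3F ≢ c → Fork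
    centred-at-2 f1≢c f3≢c =
      f 2F , f 0F , f 4F , f 1F , f 3F , f-≢ (λ ()) , f-≢ (λ ()) , f-≢ (λ ()) ,
      neighbours-within 1F 0F 2F f1≢c (cycSucc-interior refl refl) ,
      neighbours-within 3F 2F 4F f3≢c (cycSucc-interior refl refl)

    centred-at-1 : f 0F ≢ c → f 2F ≢ c → Fork
    centred-at-1 f0≢c f2≢c =
      f 1F , f last , f 3F , f 0F , f 2F , f-≢ (λ ()) , f-≢ (λ ()) , f-≢ (λ ()) ,
      neighbours-within 0F last 1F f0≢c (cycSucc-first refl refl (cong suc (toℕ-fromℕ (4 + m)))) ,
      neighbours-within 2F 1F 3F f2≢c (cycSucc-interior refl refl)

    fork : Dec (f 1F ≡ c) → Dec (f 3F ≡ c) → Fork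
    fork (no f1≢c) (no f3≢c) = centred-at-2 f1≢c f3≢c
    fork (yes f1≡c) _        = centred-at-1 (f≢c f1≡c (λ ())) (f≢c f1≡c (λ ()))
    fork (no _) (yes f3≡c)   = centred-at-1 (f≢c f3≡c (λ ())) (f≢c f3≡c (λ ()))

  cycle⇒fork : ¬ IsCycleOn G 4 B → ∀ k → IsCycleOn G k B → Fork
  cycle⇒fork _ 0 (() , _)
  cycle⇒fork _ 1 (s≤s () , _)
  cycle⇒fork _ 2 (s≤s (s≤s ()) , _)
  cycle⇒fork _ 3 cycle = triangle⇒fork cycle
  cycle⇒fork ¬C₄ 4 cycle = ⊥-elim (¬C₄ cycle)
  cycle⇒fork _ (suc (suc (suc (suc (suc m))))) cycle = long-cycle⇒fork m cycle

  endBlock⇒trap : IsCactus G → (∀ B → IsEndBlock G B → ¬ IsCycleOn G 4 B) → Trap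
  endBlock⇒trap (_ , blocks) no-C₄ with blocks B (proj₁ endBlock)
  ... | inj₁ K₁ = inj₁ (K₁⇒pendant K₁)
  ... | inj₂ (inj₁ K₂) = inj₁ (K₂⇒pendant K₂)
  ... | inj₂ (inj₂ (k , cycle)) = inj₂ (cycle⇒fork (no-C₄ B endBlock) k cycle)

lemma5p3 : (n : ℕ) (G : Graph (suc n)) → IsCactus G →
    (∀ (B : Subset (suc n)) → IsEndBlock G B → ¬ IsCycleOn G 4 B) →
    StallerWinsSGame G
lemma5p3 n G cactus no-C₄ = trap⇒stallerWins (decidable-stable trap? ¬¬-trap)
  where
  open Game G
  ¬¬-trap : ¬ ¬ Trap
  ¬¬-trap = ¬¬-map (λ E → Traps.endBlock⇒trap G E cactus no-C₄)
                   (EndBlocks.¬¬-attachedEndBlock G 0F (proj₁ cactus))
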